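{- Let $G$ be a finite graph. Then the combinatorial Alexander dual $\mathcal{I}(\mathcal{N}_G)^\vee$ of the independence complex of the neighborhood hypergraph $\mathcal{N}_G$ coincides with the closed neighborhood complex $\mathcal{N}[\overline{G}]$.
   Context: A finite graph $G$ is a finite set $V(G)$ with a symmetric irreflexive edge relation; $\overline G$ is its complement graph. The open neighborhood of $v$ is $N_G(v)=\{w:(v,w)\in E(G)\}$ and the closed neighborhood is $N_G[v]=N_G(v)\cup\{v\}$. The closed neighborhood complex $\mathcal{N}[H]$ of a graph $H$ is the simplicial complex on $V(H)$ whose simplices are the subsets $\sigma$ with $\sigma\subset N_H[v]$ for some $v\in V(H)$. A hypergraph $H$ is a pair of a finite set $V(H)$ and a family $E(H)$ of subsets of $V(H)$; a subset $\sigma\subset V(H)$ is independent if no $e\in E(H)$ satisfies $e\subset\sigma$, and the independence complex $\mathcal{I}(H)$ is the simplicial complex on $V(H)$ of independent sets. The neighborhood hypergraph $\mathcal{N}_G$ has vertex set $V(G)$ and hyperedges $\{N_G(v):v\in V(G)\}$. For a simplicial complex $K$ on a finite ground set $X$, its combinatorial Alexander dual is $K^\vee=\{\sigma\subset X : X\setminus\sigma\notin K\}$, a simplicial complex on $X$. Simplicial complexes are regarded as families of subsets (containing $\emptyset$), and "coincides" means equality of these families. -}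

module Defs where

open import Data.Nat using (ℕ)
open import Data.Fin using (Fin)
open import Data.Fin.Subset using (Subset; _∈_; _⊆_; ∁)
open import Data.Product using (Σ; ∃; _×_)
open import Data.Sum using (_⊎_)
open import Relation.Nullary using (¬_)
open import Relation.Binary.PropositionalEquality using (_≡_; _≢_)
open import Relation.Binary.Definitions using (Symmetric; Irreflexive; Decidable)
open import Level using (0ℓ; suc)

-- A finite graph on vertex set Fin n: symmetric, irreflexive edge relation
-- (decidable, as it is for any finite graph).
record Graph (n : ℕ) : Set₁ where
  field
    Adj   : Fin n → Fin n → Set
    sym   : Symmetric Adj
    irr   : Irreflexive _≡_ Adj
    dec   : Decidable Adj
open Graph public

complement : ∀ {n} → Graph n → Graph n
complement {n} G = record
  { Adj = λ v w → (v ≢ w) × ¬ Adj G v w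
  ; sym = λ { (v≢w , ¬e) → (λ eq → v≢w (Relation.Binary.PropositionalEquality.sym eq)) , (λ e → ¬e (Graph.sym G e)) }
  ; irr = λ { refl (v≢v , _) → v≢v refl }
  ; dec = decC
  }
  where
  open import Relation.Binary.PropositionalEquality using (refl)
  open import Relation.Nullary using (yes; no)
  open import Data.Fin using (_≟_)
  open import Data.Product using (_,_)
  decC : Decidable (λ v w → (v ≢ w) × ¬ Adj G v w)
  decC v w with v ≟ w | dec G v w
  ... | yes eq | _ = no λ { (ne , _) → ne eq }
  ... | no ne | yes e = no λ { (_ , ¬e) → ¬e e }
  ... | no ne | no ¬e = yes (ne , ¬e)

Complex : ℕ → Set₁
Complex n = Subset n → Set

_∈N⟨_⟩_ : ∀ {n} → Fin n → Graph n → Fin n → Set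
w ∈N⟨ G ⟩ v = Adj G v w

_∈N[_]_ : ∀ {n} → Fin n → Graph n → Fin n → Set
w ∈N[ G ] v = (w ≡ v) ⊎ Adj G v w

closedNbhdComplex : ∀ {n} → Graph n → Complex n
closedNbhdComplex H σ = ∃ λ v → ∀ w → w ∈ σ → w ∈N[ H ] v

record Hypergraph (n : ℕ) : Set₁ where
  field
    Idx  : Set
    edge : Idx → Fin n → Set
open Hypergraph public

independenceComplex : ∀ {n} → Hypergraph n → Complex n
independenceComplex H σ = ¬ (∃ λ (i : Idx H) → ∀ w → edge H i w → w ∈ σ)

nbhdHypergraph : ∀ {n} → Graph n → Hypergraph n
nbhdHypergraph {n} G = record { Idx = Fin n ; edge = λ v w → w ∈N⟨ G ⟩ v }

alexanderDual : ∀ {n} → Complex n → Complex n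
alexanderDual K σ = ¬ K (∁ σ)

_≐_ : ∀ {n} → Complex n → Complex n → Set
K ≐ L = ∀ σ → (K σ → L σ) × (L σ → K σ)

{-# OPTIONS --safe #-}
module Submission where

-- The closed neighbourhood of v in the complement of G is the complement of the open
-- neighbourhood of v in G.  Hence σ ⊆ N_Ḡ[v] iff N_G(v) ⊆ ∁σ, and by definition of the
-- dual, σ ∈ 𝓘(𝓝_G)^∨ iff it is not the case that no N_G(v) lies in ∁σ.  The resulting
-- double negation is removed because "some N_G(v) lies in τ" is decidable for finite G.

open import Data.Nat using (ℕ)
open import Data.Fin using (_≟_)
open import Data.Fin.Subset using (Subset; _∈_; ∁)
open import Data.Fin.Subset.Properties using (_∈?_; x∈∁p⇒x∉p; x∉p⇒x∈∁p)
open import Data.Fin.Properties using (all?; any?)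
open import Data.Product using (_,_; ∃; map₂)
open import Data.Sum using (inj₁; inj₂)
open import Function.Bundles using (_⇔_; mk⇔; Equivalence)
open import Function.Properties.Equivalence using () renaming (trans to ⇔-trans)
open import Relation.Nullary using (Dec; yes; no; ¬_)
open import Relation.Nullary.Decidable using (decidable-stable; _→-dec_)
open import Relation.Nullary.Negation using (contradiction)
open import Relation.Binary.PropositionalEquality using (refl; ≢-sym)
open import Defs

∃-cong-⇔ : ∀ {a b c} {A : Set a} {B : A → Set b} {C : A → Set c} →
  (∀ x → B x ⇔ C x) → (∃ B) ⇔ (∃ C)
∃-cong-⇔ B⇔C = mk⇔ (map₂ λ {x} → Equivalence.to (B⇔C x)) (map₂ λ {x} → Equivalence.from (B⇔C x))

module _ {n : ℕ} (G : Graph n) where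

  ∈N[complement]⇔∉N : ∀ {v w} → w ∈N[ complement G ] v ⇔ (¬ w ∈N⟨ G ⟩ v)
  ∈N[complement]⇔∉N {v} {w} = mk⇔ to from
    where
    to : w ∈N[ complement G ] v → ¬ w ∈N⟨ G ⟩ v
    to (inj₁ refl)      = irr G refl
    to (inj₂ (_ , v≁w)) = v≁w

    from : ¬ w ∈N⟨ G ⟩ v → w ∈N[ complement G ] v
    from v≁w with w ≟ v
    ... | yes w≡v = inj₁ w≡v
    ... | no  w≢v = inj₂ (≢-sym w≢v , v≁w)

  N⊆∁⇔⊆N[complement] : ∀ (σ : Subset n) v →
    (∀ w → w ∈N⟨ G ⟩ v → w ∈ ∁ σ) ⇔ (∀ w → w ∈ σ → w ∈N[ complement G ] v)
  N⊆∁⇔⊆N[complement] σ v = mk⇔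
    (λ N⊆∁σ w w∈σ → from ∈N[complement]⇔∉N (λ v∼w → x∈∁p⇒x∉p (N⊆∁σ w v∼w) w∈σ))
    (λ σ⊆N̄ w v∼w → x∉p⇒x∈∁p (λ w∈σ → to ∈N[complement]⇔∉N (σ⊆N̄ w w∈σ) v∼w))
    where open Equivalence

  some-N⊆? : ∀ (τ : Subset n) → Dec (∃ λ v → ∀ w → w ∈N⟨ G ⟩ v → w ∈ τ)
  some-N⊆? τ = any? λ v → all? λ w → dec G v w →-dec (w ∈? τ)

  ∈dual-independence⇔some-N⊆∁ : ∀ (σ : Subset n) →
    alexanderDual (independenceComplex (nbhdHypergraph G)) σ ⇔ (∃ λ v → ∀ w → w ∈N⟨ G ⟩ v → w ∈ ∁ σ)
  ∈dual-independence⇔some-N⊆∁ σ = mk⇔ (decidable-stable (some-N⊆? (∁ σ))) contradiction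

theorem1p4 : (n : ℕ) (G : Graph n) →
    alexanderDual (independenceComplex (nbhdHypergraph G)) ≐ closedNbhdComplex (complement G)
theorem1p4 n G σ = Equivalence.to dual⇔N̄ , Equivalence.from dual⇔N̄
  where
  dual⇔N̄ : alexanderDual (independenceComplex (nbhdHypergraph G)) σ ⇔ closedNbhdComplex (complement G) σ
  dual⇔N̄ = ⇔-trans (∈dual-independence⇔some-N⊆∁ G σ) (∃-cong-⇔ (N⊆∁⇔⊆N[complement] G σ))
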